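{- For a positive integer $j$ and a positive integer $m$ consider the sequence $(1,2,3,\dots,j,j+1,m,m,\dots,m)$ in which $m$ is repeated $2j$ times. Let $j_1<j_2<j_3<\cdots$ be the positive integers $j$ for which there exists a positive integer $m$ such that this sequence satisfies $\nu=0$, and let $m_k$ be the corresponding (unique) $m$ for $j_k$. Then $$\sum_{k\ge 0} j_{k+1}x^k=\frac{x^4+x^3-19x^2-5x-2}{(x-1)(1-6x+x^2)(1+6x+x^2)},\qquad \sum_{k\ge0} m_{k+1}x^k=\frac{6(1+x)^2}{(1-x)(1-6x+x^2)(1+6x+x^2)}.$$
   Context: For a finite sequence $(a_1,\dots,a_N)$ (repetitions allowed), $\nu(a_1,\dots,a_N)=\big(\sum a_i\big)^2-\sum a_i^3$. -}

module Defs where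

open import Data.Nat as ℕ using (ℕ; zero; suc; _≤_; _<_; _∸_)
open import Data.Integer as ℤ using (ℤ; +_; 0ℤ)
open import Data.List using (List; []; _∷_; map; foldr; _++_; replicate; applyUpTo; upTo)
open import Data.Product using (_×_; ∃; Σ)
open import Relation.Binary.PropositionalEquality using (_≡_)

sumℤ : List ℤ → ℤ
sumℤ = foldr ℤ._+_ 0ℤ

ν : List ℤ → ℤ
ν as = (sumℤ as ℤ.* sumℤ as) ℤ.- sumℤ (map (λ a → a ℤ.* a ℤ.* a) as)

seqJM : ℕ → ℕ → List ℤ
seqJM j m = map +_ (applyUpTo suc (suc j)) ++ replicate (2 ℕ.* j) (+ m)

Good : ℕ → Set
Good j = (1 ≤ j) × ∃ λ m → (1 ≤ m) × (ν (seqJM j m) ≡ 0ℤ)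

-- Polynomials with integer coefficients, as ascending coefficient lists
Poly : Set
Poly = List ℤ

infixl 6 _+ₚ_
infixl 7 _*ₚ_

_+ₚ_ : Poly → Poly → Poly
[] +ₚ q = q
p +ₚ [] = p
(a ∷ p) +ₚ (b ∷ q) = (a ℤ.+ b) ∷ (p +ₚ q)

_*ₚ_ : Poly → Poly → Poly
[] *ₚ q = []
(a ∷ p) *ₚ q = map (a ℤ.*_) q +ₚ (0ℤ ∷ (p *ₚ q))

coeff : Poly → ℕ → ℤ
coeff [] n = 0ℤ
coeff (a ∷ p) zero = a
coeff (a ∷ p) (suc n) = coeff p n

Series : Set
Series = ℕ → ℤ

_⋆_ : Poly → Series → Series
(p ⋆ f) n = sumℤ (map (λ i → coeff p i ℤ.* f (n ∸ i)) (upTo (suc n)))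

-- The formal power series identity  f = N / D  (D has nonzero constant term),
-- expressed as D · f = N in ℤ[[x]].
HasGF : Series → Poly → Poly → Set
HasGF f N D = ∀ n → (D ⋆ f) n ≡ coeff N n

xm1 p1 p2 : Poly
xm1 = ℤ.- (+ 1) ∷ + 1 ∷ []
p1 = + 1 ∷ ℤ.- (+ 6) ∷ + 1 ∷ []
p2 = + 1 ∷ + 6 ∷ + 1 ∷ []

om : Poly
om = + 1 ∷ ℤ.- (+ 1) ∷ []

numJ : Poly
numJ = ℤ.- (+ 2) ∷ ℤ.- (+ 5) ∷ ℤ.- (+ 19) ∷ + 1 ∷ + 1 ∷ []

denJ : Poly
denJ = xm1 *ₚ p1 *ₚ p2

numM : Poly
numM = (+ 6 ∷ []) *ₚ ((+ 1 ∷ + 1 ∷ []) *ₚ (+ 1 ∷ + 1 ∷ []))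

denM : Poly
denM = om *ₚ p1 *ₚ p2

{-# OPTIONS --safe #-}
-- By the formulas of Gauss and Nicomachus, 4ν = 8jm((j+1)(j+2) + 2jm − m²) for the sequence
-- (1,…,j+1,m,…,m), so ν = 0 exactly when m = j + y with y² = 2j² + 3j + 2, i.e. (4j+3)² − 8y² = −7.
-- Multiplication by the unit 17 + 6√8 permutes these solutions, and its inverse sends a solution
-- with j ≥ 29 to a smaller one, while below 29 only j = 2 and j = 7 occur. So the admissible j,
-- in increasing order, alternate between the orbits of (2,4) and (7,11); both j and m then satisfy
-- a(k+4) = 34 a(k+2) − a(k) + 24, which is the stated rational generating function.
module Submission where

open import Defs
open import Data.Nat using (ℕ; suc; _≤_; _<_)
open import Data.Integer using (+_)
open import Data.Product using (_×_; ∃)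
open import Function.Bundles using (_⇔_)
open import Relation.Binary.PropositionalEquality using (_≡_)
open import Data.Integer using (0ℤ)

open import Data.Nat using (z≤n; s≤s)
open import Data.Nat.Properties using (≤-trans; m≤m+n)
open import Data.Product using (_,_; proj₁; proj₂)
open import Function.Bundles using (module Equivalence)
open import Relation.Binary.PropositionalEquality using (refl; sym; trans; cong; cong₂; subst; module ≡-Reasoning)

module PowerSums where
  open import Data.Nat using (zero)
  open import Data.Integer using (ℤ; _+_; _*_)
  open import Data.Integer.Properties using (+-identityˡ; +-identityʳ; +-assoc; *-zeroʳ; suc-*; *-distribˡ-+)
  open import Data.Integer.Tactic.RingSolver using (solve-∀)
  open import Data.List using ([]; _∷_; _++_; [_]; _∷ʳ_; map; replicate; applyUpTo)
  open import Data.List.Properties using (map-++; applyUpTo-∷ʳ)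
  open import Function using (_∘_)
  open ≡-Reasoning

  sumℤ-++ : ∀ xs ys → sumℤ (xs ++ ys) ≡ sumℤ xs + sumℤ ys
  sumℤ-++ []       ys = sym (+-identityˡ (sumℤ ys))
  sumℤ-++ (x ∷ xs) ys = trans (cong (_+_ x) (sumℤ-++ xs ys)) (sym (+-assoc x (sumℤ xs) (sumℤ ys)))

  sumℤ-replicate : ∀ n a → sumℤ (replicate n a) ≡ + n * a
  sumℤ-replicate zero    a = refl
  sumℤ-replicate (suc n) a = trans (cong (_+_ a) (sumℤ-replicate n a)) (sym (suc-* (+ n) a))

  sumℤ-map-∷ʳ : ∀ {A : Set} (f : A → ℤ) xs x → sumℤ (map f (xs ∷ʳ x)) ≡ sumℤ (map f xs) + f x
  sumℤ-map-∷ʳ f xs x = begin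
    sumℤ (map f (xs ∷ʳ x))          ≡⟨ cong sumℤ (map-++ f xs [ x ]) ⟩
    sumℤ (map f xs ++ [ f x ])      ≡⟨ sumℤ-++ (map f xs) [ f x ] ⟩
    sumℤ (map f xs) + (f x + 0ℤ)    ≡⟨ cong (_+_ (sumℤ (map f xs))) (+-identityʳ (f x)) ⟩
    sumℤ (map f xs) + f x           ∎

  telescope : ∀ k (g F : ℕ → ℤ) → F 0 ≡ 0ℤ → (∀ n → F (suc n) ≡ F n + k * g (suc n)) →
              ∀ n → k * sumℤ (map g (applyUpTo suc n)) ≡ F n
  telescope k g F F0 step zero    = trans (*-zeroʳ k) (sym F0)
  telescope k g F F0 step (suc n) = begin
    k * sumℤ (map g (applyUpTo suc (suc n)))           ≡⟨ cong (λ xs → k * sumℤ (map g xs)) (sym (applyUpTo-∷ʳ suc n)) ⟩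
    k * sumℤ (map g (applyUpTo suc n ∷ʳ suc n))        ≡⟨ cong (k *_) (sumℤ-map-∷ʳ g (applyUpTo suc n) (suc n)) ⟩
    k * (sumℤ (map g (applyUpTo suc n)) + g (suc n))   ≡⟨ *-distribˡ-+ k _ (g (suc n)) ⟩
    k * sumℤ (map g (applyUpTo suc n)) + k * g (suc n) ≡⟨ cong (_+ k * g (suc n)) (telescope k g F F0 step n) ⟩
    F n + k * g (suc n)                                ≡⟨ sym (step n) ⟩
    F (suc n)                                          ∎

  cube : ℤ → ℤ
  cube a = a * a * a

  sum-naturals : ∀ n → + 2 * sumℤ (map +_ (applyUpTo suc n)) ≡ + n * (+ n + + 1)
  sum-naturals = telescope (+ 2) +_ (λ n → + n * (+ n + + 1)) refl (λ n → step (+ n))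
    where
    step : ∀ N → (+ 1 + N) * (+ 1 + N + + 1) ≡ N * (N + + 1) + + 2 * (+ 1 + N)
    step = solve-∀

  sum-cubes : ∀ n → + 4 * sumℤ (map (cube ∘ +_) (applyUpTo suc n)) ≡ (+ n * (+ n + + 1)) * (+ n * (+ n + + 1))
  sum-cubes = telescope (+ 4) (cube ∘ +_) (λ n → (+ n * (+ n + + 1)) * (+ n * (+ n + + 1))) refl (λ n → step (+ n))
    where
    step : ∀ N → ((+ 1 + N) * (+ 1 + N + + 1)) * ((+ 1 + N) * (+ 1 + N + + 1))
               ≡ (N * (N + + 1)) * (N * (N + + 1)) + + 4 * ((+ 1 + N) * (+ 1 + N) * (+ 1 + N))
    step = solve-∀

module Factorisation where
  open import Data.Nat as ℕ using ()
  open import Data.Integer using (ℤ; _+_; _-_; _*_)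
  open import Data.Integer.Properties using (pos-*; +-injective; i-j≡0⇒i≡j; +-inverseʳ; *-zeroʳ; *-cancelˡ-≡)
  open import Data.Integer.Tactic.RingSolver using (solve-∀)
  open import Data.List using (_++_; map; replicate; applyUpTo)
  open import Data.List.Properties using (map-++; map-∘; map-replicate; map-id)
  open import Function using (_∘_; id)
  open PowerSums
  open ≡-Reasoning

  sum-map-seqJM : ∀ (f : ℤ → ℤ) j m →
    sumℤ (map f (seqJM j m)) ≡ sumℤ (map (f ∘ +_) (applyUpTo suc (suc j))) + + 2 * + j * f (+ m)
  sum-map-seqJM f j m = begin
    sumℤ (map f (map +_ L ++ R))                        ≡⟨ cong sumℤ (map-++ f (map +_ L) R) ⟩
    sumℤ (map f (map +_ L) ++ map f R)                  ≡⟨ sumℤ-++ (map f (map +_ L)) (map f R) ⟩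
    sumℤ (map f (map +_ L)) + sumℤ (map f R)            ≡⟨ cong₂ _+_ (cong sumℤ (sym (map-∘ {g = f} {f = +_} L))) (cong sumℤ (map-replicate f (2 ℕ.* j) (+ m))) ⟩
    sumℤ (map (f ∘ +_) L) + sumℤ (replicate (2 ℕ.* j) (f (+ m)))
                                                        ≡⟨ cong (_+_ (sumℤ (map (f ∘ +_) L))) (sumℤ-replicate (2 ℕ.* j) (f (+ m))) ⟩
    sumℤ (map (f ∘ +_) L) + + (2 ℕ.* j) * f (+ m)       ≡⟨ cong (λ t → sumℤ (map (f ∘ +_) L) + t * f (+ m)) (pos-* 2 j) ⟩
    sumℤ (map (f ∘ +_) L) + + 2 * + j * f (+ m)         ∎
    where
    L = applyUpTo suc (suc j)
    R = replicate (2 ℕ.* j) (+ m)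

  νFactor : ℤ → ℤ → ℤ
  νFactor j m = (j + + 1) * (j + + 2) + + 2 * j * m - m * m

  ν-seqJM : ∀ j m → + 4 * ν (seqJM j m) ≡ + 8 * + j * + m * νFactor (+ j) (+ m)
  ν-seqJM j m = begin
    + 4 * ν (seqJM j m)
      ≡⟨ cong₂ (λ s c → + 4 * (s * s - c)) (trans (cong sumℤ (sym (map-id (seqJM j m)))) (sum-map-seqJM id j m)) (sum-map-seqJM cube j m) ⟩
    + 4 * ((S + + 2 * + j * + m) * (S + + 2 * + j * + m) - (C + + 2 * + j * cube (+ m)))
      ≡⟨ expand S C (+ j) (+ m) ⟩
    (+ 2 * S + + 4 * + j * + m) * (+ 2 * S + + 4 * + j * + m) - + 4 * C - + 8 * + j * cube (+ m)
      ≡⟨ cong₂ (λ s c → (s + + 4 * + j * + m) * (s + + 4 * + j * + m) - c - + 8 * + j * cube (+ m)) (sum-naturals (suc j)) (sum-cubes (suc j)) ⟩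
    (t + + 4 * + j * + m) * (t + + 4 * + j * + m) - t * t - + 8 * + j * cube (+ m)
      ≡⟨ factor (+ j) (+ m) ⟩
    + 8 * + j * + m * νFactor (+ j) (+ m) ∎
    where
    S = sumℤ (map +_ (applyUpTo suc (suc j)))
    C = sumℤ (map (cube ∘ +_) (applyUpTo suc (suc j)))
    t = + suc j * (+ suc j + + 1)
    expand : ∀ S C J M → + 4 * ((S + + 2 * J * M) * (S + + 2 * J * M) - (C + + 2 * J * (M * M * M)))
                       ≡ (+ 2 * S + + 4 * J * M) * (+ 2 * S + + 4 * J * M) - + 4 * C - + 8 * J * (M * M * M)
    expand = solve-∀
    factor : ∀ J M → ((+ 1 + J) * (+ 1 + J + + 1) + + 4 * J * M) * ((+ 1 + J) * (+ 1 + J + + 1) + + 4 * J * M)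
                     - ((+ 1 + J) * (+ 1 + J + + 1)) * ((+ 1 + J) * (+ 1 + J + + 1)) - + 8 * J * (M * M * M)
                   ≡ + 8 * J * M * ((J + + 1) * (J + + 2) + + 2 * J * M - M * M)
    factor = solve-∀

  νRoot : ℕ → ℕ → Set
  νRoot j m = (j ℕ.+ 1) ℕ.* (j ℕ.+ 2) ℕ.+ 2 ℕ.* j ℕ.* m ≡ m ℕ.* m

  νFactor-pos : ∀ j m → νFactor (+ j) (+ m) ≡ + ((j ℕ.+ 1) ℕ.* (j ℕ.+ 2) ℕ.+ 2 ℕ.* j ℕ.* m) - + (m ℕ.* m)
  νFactor-pos j m = sym (cong₂ _-_
    (cong₂ _+_ (pos-* (j ℕ.+ 1) (j ℕ.+ 2)) (trans (pos-* (2 ℕ.* j) m) (cong (_* + m) (pos-* 2 j))))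
    (pos-* m m))

  ν≡0⇒νRoot : ∀ {j m} → 1 ℕ.≤ j → 1 ℕ.≤ m → ν (seqJM j m) ≡ 0ℤ → νRoot j m
  ν≡0⇒νRoot {suc j} {suc m} _ _ ν≡0 = +-injective (i-j≡0⇒i≡j _ _ (trans (sym (νFactor-pos (suc j) (suc m))) F≡0))
    where
    F≡0 : νFactor (+ suc j) (+ suc m) ≡ 0ℤ
    F≡0 = *-cancelˡ-≡ (+ 8 * + suc j * + suc m) (νFactor (+ suc j) (+ suc m)) 0ℤ (begin
      + 8 * + suc j * + suc m * νFactor (+ suc j) (+ suc m) ≡⟨ sym (ν-seqJM (suc j) (suc m)) ⟩
      + 4 * ν (seqJM (suc j) (suc m))                       ≡⟨ cong (_*_ (+ 4)) ν≡0 ⟩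
      0ℤ                                                    ≡⟨ sym (*-zeroʳ (+ 8 * + suc j * + suc m)) ⟩
      + 8 * + suc j * + suc m * 0ℤ                          ∎)

  νRoot⇒ν≡0 : ∀ {j m} → νRoot j m → ν (seqJM j m) ≡ 0ℤ
  νRoot⇒ν≡0 {j} {m} root = *-cancelˡ-≡ (+ 4) (ν (seqJM j m)) 0ℤ (begin
    + 4 * ν (seqJM j m)                   ≡⟨ ν-seqJM j m ⟩
    + 8 * + j * + m * νFactor (+ j) (+ m) ≡⟨ cong (_*_ (+ 8 * + j * + m)) F≡0 ⟩
    + 8 * + j * + m * 0ℤ                  ≡⟨ *-zeroʳ (+ 8 * + j * + m) ⟩
    0ℤ                                    ∎)
    where
    F≡0 : νFactor (+ j) (+ m) ≡ 0ℤ
    F≡0 = trans (νFactor-pos j m) (trans (cong (λ a → + a - + (m ℕ.* m)) root) (+-inverseʳ (+ (m ℕ.* m))))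

module GeneratingFunctions where
  open import Data.Nat as ℕ using (_∸_)
  open import Data.Integer using (ℤ; _+_; _-_; _*_; -_)
  open import Data.Integer.Properties using (pos-*)
  open import Data.Integer.Tactic.RingSolver using (solve-∀)
  open import Data.List using ([]; _∷_; map; upTo; applyUpTo)
  open import Data.List.Properties using (map-cong)
  open ≡-Reasoning

  ⋆-cong : ∀ D {f g : Series} → (∀ k → f k ≡ g k) → ∀ n → (D ⋆ f) n ≡ (D ⋆ g) n
  ⋆-cong D f≗g n = cong sumℤ (map-cong (λ i → cong (_*_ (coeff D i)) (f≗g (n ∸ i))) (upTo (suc n)))

  HasGF-cong : ∀ {f g N D} → (∀ k → f k ≡ g k) → HasGF f N D → HasGF g N D
  HasGF-cong {D = D} f≗g gf n = trans (sym (⋆-cong D f≗g n)) (gf n)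

  sumℤ-applyUpTo-zeros : ∀ (g : ℕ → ℤ) h n → (∀ i → g (h i) ≡ 0ℤ) → sumℤ (map g (applyUpTo h n)) ≡ 0ℤ
  sumℤ-applyUpTo-zeros g h ℕ.zero    g∘h≡0 = refl
  sumℤ-applyUpTo-zeros g h (suc n) g∘h≡0 =
    cong₂ _+_ (g∘h≡0 0) (sumℤ-applyUpTo-zeros g (λ i → h (suc i)) n (λ i → g∘h≡0 (suc i)))

  ⋆-sextic : ∀ a₀ a₁ a₂ a₃ a₄ a₅ (f : Series) n →
    ((a₀ ∷ a₁ ∷ a₂ ∷ a₃ ∷ a₄ ∷ a₅ ∷ []) ⋆ f) (5 ℕ.+ n)
      ≡ a₀ * f (5 ℕ.+ n) + (a₁ * f (4 ℕ.+ n) + (a₂ * f (3 ℕ.+ n) + (a₃ * f (2 ℕ.+ n) + (a₄ * f (1 ℕ.+ n) + (a₅ * f n + 0ℤ)))))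
  -- The omitted terms have coefficient index ≥ 6, so they reduce to 0ℤ.
  ⋆-sextic a₀ a₁ a₂ a₃ a₄ a₅ f n =
    cong (λ r → a₀ * f (5 ℕ.+ n) + (a₁ * f (4 ℕ.+ n) + (a₂ * f (3 ℕ.+ n) + (a₃ * f (2 ℕ.+ n) + (a₄ * f (1 ℕ.+ n) + (a₅ * f n + r))))))
         (sumℤ-applyUpTo-zeros _ (λ i → 6 ℕ.+ i) n (λ _ → refl))

  Recurrence : (ℕ → ℕ) → Set
  Recurrence a = ∀ n → a (4 ℕ.+ n) ℕ.+ a n ≡ 34 ℕ.* a (2 ℕ.+ n) ℕ.+ 24

  -- The polynomial below is c (1 - x) (1 - 34x² + x⁴), and 1 - 34x² + x⁴ = (1 - 6x + x²)(1 + 6x + x²).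
  recurrence-annihilated : ∀ c {a} → Recurrence a → ∀ n →
    ((c ∷ - c ∷ - (+ 34 * c) ∷ + 34 * c ∷ c ∷ - c ∷ []) ⋆ (λ k → + a k)) (5 ℕ.+ n) ≡ 0ℤ
  recurrence-annihilated c {a} rec n = begin
    ((c ∷ - c ∷ - (+ 34 * c) ∷ + 34 * c ∷ c ∷ - c ∷ []) ⋆ (λ k → + a k)) (5 ℕ.+ n)
      ≡⟨ ⋆-sextic c (- c) (- (+ 34 * c)) (+ 34 * c) c (- c) (λ k → + a k) n ⟩
    c * A₅ + (- c * A₄ + (- (+ 34 * c) * A₃ + (+ 34 * c * A₂ + (c * A₁ + (- c * A₀ + 0ℤ)))))
      ≡⟨ regroup c A₀ A₁ A₂ A₃ A₄ A₅ ⟩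
    c * (A₅ + A₁ - + 34 * A₃) - c * (A₄ + A₀ - + 34 * A₂)
      ≡⟨ cong₂ (λ u v → c * (u - + 34 * A₃) - c * (v - + 34 * A₂)) (recℤ (suc n)) (recℤ n) ⟩
    c * (+ 34 * A₃ + + 24 - + 34 * A₃) - c * (+ 34 * A₂ + + 24 - + 34 * A₂)
      ≡⟨ cancel c A₂ A₃ ⟩
    0ℤ ∎
    where
    A₀ = + a n
    A₁ = + a (1 ℕ.+ n)
    A₂ = + a (2 ℕ.+ n)
    A₃ = + a (3 ℕ.+ n)
    A₄ = + a (4 ℕ.+ n)
    A₅ = + a (5 ℕ.+ n)
    recℤ : ∀ n → + a (4 ℕ.+ n) + + a n ≡ + 34 * + a (2 ℕ.+ n) + + 24
    recℤ n = trans (cong +_ (rec n)) (cong (_+ + 24) (pos-* 34 (a (2 ℕ.+ n))))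
    regroup : ∀ c A₀ A₁ A₂ A₃ A₄ A₅ →
      c * A₅ + (- c * A₄ + (- (+ 34 * c) * A₃ + (+ 34 * c * A₂ + (c * A₁ + (- c * A₀ + 0ℤ)))))
        ≡ c * (A₅ + A₁ - + 34 * A₃) - c * (A₄ + A₀ - + 34 * A₂)
    regroup = solve-∀
    cancel : ∀ c A₂ A₃ → c * (+ 34 * A₃ + + 24 - + 34 * A₃) - c * (+ 34 * A₂ + + 24 - + 34 * A₂) ≡ 0ℤ
    cancel = solve-∀

module PellEquation where
  open import Data.Nat using (zero; _+_; _*_; _∸_; _≟_; s≤s⁻¹)
  open import Data.Nat.Properties
    using (_<?_; ≤-trans; ≤-reflexive; <-≤-trans; <⇒≱; ≮⇒≥; ≤-antisym; *-mono-<; *-mono-≤; m≤m+n; m<m+n;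
           +-cancelˡ-≡; +-cancelʳ-≡; +-cancelʳ-<; +-monoʳ-<; +-monoˡ-<; +-mono-<; +-monoˡ-≤; *-monoʳ-<; *-monoʳ-≤;
           m∸n+n≡m; m+[n∸m]≡n; m≤n⇒∃[o]m+o≡n; allUpTo?; module ≤-Reasoning)
  open import Data.Nat.Tactic.RingSolver using (solve-∀)
  open import Data.Nat.Induction using (<-rec)
  open import Data.Product.Relation.Binary.Pointwise.NonDependent using (Pointwise)
  open import Data.Sum using (_⊎_; [_,_])
  open import Relation.Nullary using (Dec; yes; no; contradiction)
  open import Relation.Nullary.Decidable using (from-yes; _→-dec_; _⊎-dec_)
  open import Data.Integer as ℤ using ()
  open Factorisation using (νRoot)
  open GeneratingFunctions using (Recurrence; recurrence-annihilated)

  m*m≤n*n⇒m≤n : ∀ {m n} → m * m ≤ n * n → m ≤ n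
  m*m≤n*n⇒m≤n {m} {n} m²≤n² with n <? m
  ... | yes n<m = contradiction m²≤n² (<⇒≱ (*-mono-< n<m n<m))
  ... | no n≮m  = ≮⇒≥ n≮m

  m*m<n*n⇒m<n : ∀ {m n} → m * m < n * n → m < n
  m*m<n*n⇒m<n {m} {n} m²<n² with m <? n
  ... | yes m<n = m<n
  ... | no m≮n  = contradiction (*-mono-≤ (≮⇒≥ m≮n) (≮⇒≥ m≮n)) (<⇒≱ m²<n²)

  ≤-fromSquares : ∀ {m n} d → m * m + d ≡ n * n → m ≤ n
  ≤-fromSquares {m} d eq = m*m≤n*n⇒m≤n (≤-trans (m≤m+n (m * m) d) (≤-reflexive eq))

  <-fromSquares : ∀ {m n} d → m * m + suc d ≡ n * n → m < n
  <-fromSquares {m} d eq = m*m<n*n⇒m<n (<-≤-trans (m<m+n (m * m) (s≤s z≤n)) (≤-reflexive eq))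

  pellRHS : ℕ → ℕ
  pellRHS j = 2 * (j * j) + 3 * j + 2

  Pell : ℕ × ℕ → Set
  Pell (j , y) = y * y ≡ pellRHS j

  Pell? : ∀ p → Dec (Pell p)
  Pell? (j , y) = y * y ≟ pellRHS j

  Pell-unique : ∀ {j y y′} → Pell (j , y) → Pell (j , y′) → y ≡ y′
  Pell-unique pell pell′ = ≤-antisym (m*m≤n*n⇒m≤n (≤-reflexive e)) (m*m≤n*n⇒m≤n (≤-reflexive (sym e)))
    where e = trans pell (sym pell′)

  Pell-scaled : ∀ k {j y} → Pell (j , y) → (k * y) * (k * y) ≡ k * k * pellRHS j
  Pell-scaled k {j} {y} pell = trans (square-* k y) (cong (_*_ (k * k)) pell)
    where
    square-* : ∀ k y → (k * y) * (k * y) ≡ k * k * (y * y)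
    square-* = solve-∀

  Pell⇒y<2j+2 : ∀ {j y} → Pell (j , y) → y < 2 * j + 2
  Pell⇒y<2j+2 {j} {y} pell = <-fromSquares (2 * (j * j) + 5 * j + 1) (trans (cong (_+ suc (2 * (j * j) + 5 * j + 1)) pell) (gap j))
    where
    gap : ∀ j → 2 * (j * j) + 3 * j + 2 + suc (2 * (j * j) + 5 * j + 1) ≡ (2 * j + 2) * (2 * j + 2)
    gap = solve-∀

  Pell⇔νRoot : ∀ {j y} → Pell (j , y) ⇔ νRoot j (j + y)
  Pell⇔νRoot {j} {y} = record { to = to ; from = from ; to-cong = cong to ; from-cong = cong from }
    where
    lhs : (j + 1) * (j + 2) + 2 * j * (j + y) ≡ (j * j + 2 * j * y) + pellRHS j
    lhs = expandˡ j y
      where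
      expandˡ : ∀ j y → (j + 1) * (j + 2) + 2 * j * (j + y) ≡ (j * j + 2 * j * y) + (2 * (j * j) + 3 * j + 2)
      expandˡ = solve-∀
    rhs : (j + y) * (j + y) ≡ (j * j + 2 * j * y) + y * y
    rhs = expandʳ j y
      where
      expandʳ : ∀ j y → (j + y) * (j + y) ≡ (j * j + 2 * j * y) + y * y
      expandʳ = solve-∀
    to : Pell (j , y) → νRoot j (j + y)
    to pell = trans lhs (trans (cong (_+_ (j * j + 2 * j * y)) (sym pell)) (sym rhs))
    from : νRoot j (j + y) → Pell (j , y)
    from root = sym (+-cancelˡ-≡ (j * j + 2 * j * y) _ _ (trans (sym lhs) (trans root rhs)))

  νRoot⇒Pell : ∀ {j m} → νRoot j m → ∃ λ y → m ≡ j + y × Pell (j , y)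
  νRoot⇒Pell {j} {m} root = m ∸ j , sym j+[m∸j]≡m , Equivalence.from (Pell⇔νRoot {j} {m ∸ j}) (subst (νRoot j) (sym j+[m∸j]≡m) root)
    where
    expand : ∀ j m → j * j + (3 * j + 2 + 2 * j * m) ≡ (j + 1) * (j + 2) + 2 * j * m
    expand = solve-∀
    j+[m∸j]≡m : j + (m ∸ j) ≡ m
    j+[m∸j]≡m = m+[n∸m]≡n (≤-fromSquares {j} {m} (3 * j + 2 + 2 * j * m) (trans (expand j m) root))

  νRoot-unique : ∀ {j y m} → Pell (j , y) → νRoot j m → m ≡ j + y
  νRoot-unique {j} pell root with νRoot⇒Pell root
  ... | y′ , m≡j+y′ , pell′ = trans m≡j+y′ (cong (_+_ j) (Pell-unique {j} pell′ pell))

  -- With x = 4j + 3 the equation reads x² - 8y² = -7, and T is multiplication of x + y√8 by the unit 17 + 6√8.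
  T : ℕ × ℕ → ℕ × ℕ
  T (j , y) = 17 * j + 12 * y + 12 , 24 * j + 17 * y + 18

  T-invariant : ∀ j y → (24 * j + 17 * y + 18) * (24 * j + 17 * y + 18) + (2 * (j * j) + 3 * j + 2)
                      ≡ (2 * ((17 * j + 12 * y + 12) * (17 * j + 12 * y + 12)) + 3 * (17 * j + 12 * y + 12) + 2) + y * y
  T-invariant = solve-∀

  Pell-T : ∀ p → Pell p → Pell (T p)
  Pell-T (j , y) pell = +-cancelʳ-≡ (pellRHS j) _ _ (trans (T-invariant j y) (cong (_+_ (pellRHS (17 * j + 12 * y + 12))) pell))

  Pell-T⁻¹ : ∀ p → Pell (T p) → Pell p
  Pell-T⁻¹ (j , y) pell = +-cancelˡ-≡ (pellRHS (17 * j + 12 * y + 12)) _ _ (trans (sym (T-invariant j y)) (cong (_+ pellRHS j) pell))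

  T-mono : ∀ {p q} → Pointwise _<_ _<_ p q → Pointwise _<_ _<_ (T p) (T q)
  T-mono (j<j′ , y<y′) = +-monoˡ-< 12 (+-mono-< (*-monoʳ-< 17 j<j′) (*-monoʳ-< 12 y<y′))
                       , +-monoˡ-< 18 (+-mono-< (*-monoʳ-< 24 j<j′) (*-monoʳ-< 17 y<y′))

  T-preimage : ∀ {j y j′ y′} → j′ + 12 * y ≡ 17 * j + 12 → y′ + (24 * j + 18) ≡ 17 * y → T (j′ , y′) ≡ (j , y)
  T-preimage {j} {y} {j′} {y′} e₁ e₂ = cong₂ _,_
    (+-cancelʳ-≡ (204 * y + 288 * j + 204) _ _ (begin
      17 * j′ + 12 * y′ + 12 + (204 * y + 288 * j + 204)   ≡⟨ regroup₁ j′ y′ j y ⟩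
      17 * (j′ + 12 * y) + 12 * (y′ + (24 * j + 18))      ≡⟨ cong₂ (λ u v → 17 * u + 12 * v) e₁ e₂ ⟩
      17 * (17 * j + 12) + 12 * (17 * y)                  ≡⟨ regroup₂ j y ⟩
      j + (204 * y + 288 * j + 204)                       ∎))
    (+-cancelʳ-≡ (288 * y + 408 * j + 288) _ _ (begin
      24 * j′ + 17 * y′ + 18 + (288 * y + 408 * j + 288)   ≡⟨ regroup₃ j′ y′ j y ⟩
      24 * (j′ + 12 * y) + 17 * (y′ + (24 * j + 18))      ≡⟨ cong₂ (λ u v → 24 * u + 17 * v) e₁ e₂ ⟩
      24 * (17 * j + 12) + 17 * (17 * y)                  ≡⟨ regroup₄ j y ⟩
      y + (288 * y + 408 * j + 288)                       ∎))
    where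
    open ≡-Reasoning
    regroup₁ : ∀ j′ y′ j y → 17 * j′ + 12 * y′ + 12 + (204 * y + 288 * j + 204) ≡ 17 * (j′ + 12 * y) + 12 * (y′ + (24 * j + 18))
    regroup₁ = solve-∀
    regroup₂ : ∀ j y → 17 * (17 * j + 12) + 12 * (17 * y) ≡ j + (204 * y + 288 * j + 204)
    regroup₂ = solve-∀
    regroup₃ : ∀ j′ y′ j y → 24 * j′ + 17 * y′ + 18 + (288 * y + 408 * j + 288) ≡ 24 * (j′ + 12 * y) + 17 * (y′ + (24 * j + 18))
    regroup₃ = solve-∀
    regroup₄ : ∀ j y → 24 * (17 * j + 12) + 17 * (17 * y) ≡ y + (288 * y + 408 * j + 288)
    regroup₄ = solve-∀

  -- Each bound compares a square with (ky)² = k²(2j² + 3j + 2); the first one needs j ≥ 29.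
  descent : ∀ {j y} → 29 ≤ j → Pell (j , y) → ∃ λ p → T p ≡ (j , y) × proj₁ p < j
  descent {j} {y} 29≤j pell = (j′ , y′) , T-preimage {j} {y} {j′} {y′} e₁ e₂ , j′<j
    where
    gap₁ : ∀ j t → 29 + t ≡ j → 12 * 12 * pellRHS j + (1 + 34 * t + t * t) ≡ (17 * j + 12) * (17 * j + 12)
    gap₁ _ t refl = expand t
      where
      expand : ∀ t → 12 * 12 * (2 * ((29 + t) * (29 + t)) + 3 * (29 + t) + 2) + (1 + 34 * t + t * t)
                     ≡ (17 * (29 + t) + 12) * (17 * (29 + t) + 12)
      expand = solve-∀
    gap₂ : ∀ j → (24 * j + 18) * (24 * j + 18) + (2 * (j * j) + 3 * j + 254) ≡ 17 * 17 * (2 * (j * j) + 3 * j + 2)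
    gap₂ = solve-∀
    gap₃ : ∀ j → (16 * j + 12) * (16 * j + 12) + suc (143 + 32 * (j * j) + 48 * j) ≡ 12 * 12 * (2 * (j * j) + 3 * j + 2)
    gap₃ = solve-∀
    t = proj₁ (m≤n⇒∃[o]m+o≡n 29≤j)
    12y≤17j+12 : 12 * y ≤ 17 * j + 12
    12y≤17j+12 = ≤-fromSquares {12 * y} {17 * j + 12} (1 + 34 * t + t * t)
      (trans (cong (_+ (1 + 34 * t + t * t)) (Pell-scaled 12 {j} {y} pell)) (gap₁ j t (proj₂ (m≤n⇒∃[o]m+o≡n 29≤j))))
    24j+18≤17y : 24 * j + 18 ≤ 17 * y
    24j+18≤17y = ≤-fromSquares {24 * j + 18} {17 * y} (2 * (j * j) + 3 * j + 254) (trans (gap₂ j) (sym (Pell-scaled 17 {j} {y} pell)))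
    16j+12<12y : 16 * j + 12 < 12 * y
    16j+12<12y = <-fromSquares {16 * j + 12} {12 * y} (143 + 32 * (j * j) + 48 * j) (trans (gap₃ j) (sym (Pell-scaled 12 {j} {y} pell)))
    j′ = 17 * j + 12 ∸ 12 * y
    y′ = 17 * y ∸ (24 * j + 18)
    e₁ : j′ + 12 * y ≡ 17 * j + 12
    e₁ = m∸n+n≡m 12y≤17j+12
    e₂ : y′ + (24 * j + 18) ≡ 17 * y
    e₂ = m∸n+n≡m 24j+18≤17y
    j′<j : j′ < j
    j′<j = +-cancelʳ-< (12 * y) j′ j (begin-strict
      j′ + 12 * y       ≡⟨ e₁ ⟩
      17 * j + 12       ≡⟨ split j ⟩
      j + (16 * j + 12) <⟨ +-monoʳ-< j 16j+12<12y ⟩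
      j + 12 * y        ∎)
      where
      open ≤-Reasoning
      split : ∀ j → 17 * j + 12 ≡ j + (16 * j + 12)
      split = solve-∀

  pellOrbit : ℕ → ℕ × ℕ
  pellOrbit zero          = 2 , 4
  pellOrbit (suc zero)    = 7 , 11
  pellOrbit (suc (suc k)) = T (pellOrbit k)

  orbitJ orbitY orbitM : ℕ → ℕ
  orbitJ k = proj₁ (pellOrbit k)
  orbitY k = proj₂ (pellOrbit k)
  orbitM k = orbitJ k + orbitY k

  pellOrbit-Pell : ∀ k → Pell (pellOrbit k)
  pellOrbit-Pell zero          = refl
  pellOrbit-Pell (suc zero)    = refl
  pellOrbit-Pell (suc (suc k)) = Pell-T (pellOrbit k) (pellOrbit-Pell k)

  pellOrbit-increasing : ∀ k → Pointwise _<_ _<_ (pellOrbit k) (pellOrbit (suc k))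
  pellOrbit-increasing zero          = from-yes (2 <? 7) , from-yes (4 <? 11)
  pellOrbit-increasing (suc zero)    = from-yes (7 <? 94) , from-yes (11 <? 134)
  pellOrbit-increasing (suc (suc k)) = T-mono (pellOrbit-increasing k)

  -- Opaque, so that uses of Pell-small do not unfold the exhaustive search.
  opaque
    Pell-small : ∀ {j} → j < 29 → ∀ {y} → y < 58 → Pell (j , y) → j ≡ 2 ⊎ j ≡ 7
    Pell-small = from-yes (allUpTo? (λ j → allUpTo? (λ y → Pell? (j , y) →-dec ((j ≟ 2) ⊎-dec (j ≟ 7))) 58) 29)

  pellOrbit-determined : ∀ k {y} → Pell (orbitJ k , y) → pellOrbit k ≡ (orbitJ k , y)
  pellOrbit-determined k pell = cong (orbitJ k ,_) (Pell-unique {orbitJ k} (pellOrbit-Pell k) pell)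

  InOrbit : ℕ → Set
  InOrbit j = ∀ y → Pell (j , y) → ∃ λ k → pellOrbit k ≡ (j , y)

  pellOrbit-complete : ∀ j → InOrbit j
  pellOrbit-complete = <-rec InOrbit step
    where
    step : ∀ j → (∀ {j′} → j′ < j → InOrbit j′) → InOrbit j
    step j rec y pell with j <? 29
    ... | yes j<29 = [ (λ { refl → 0 , pellOrbit-determined 0 pell }) , (λ { refl → 1 , pellOrbit-determined 1 pell }) ]
                       (Pell-small j<29 y<58 pell)
      where
      y<58 : y < 58
      y<58 = <-≤-trans (Pell⇒y<2j+2 {j} pell) (+-monoˡ-≤ 2 (*-monoʳ-≤ 2 (s≤s⁻¹ j<29)))
    ... | no j≮29 = 2 + proj₁ IH , trans (cong T (proj₂ IH)) T≡
      where
      D : ∃ λ p → T p ≡ (j , y) × proj₁ p < j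
      D = descent {j} {y} (≮⇒≥ j≮29) pell
      p : ℕ × ℕ
      p = proj₁ D
      T≡ : T p ≡ (j , y)
      T≡ = proj₁ (proj₂ D)
      IH : ∃ λ k → pellOrbit k ≡ p
      IH = rec (proj₂ (proj₂ D)) (proj₂ p) (Pell-T⁻¹ p (subst Pell (sym T≡) pell))

  orbitJ-recurrence : Recurrence orbitJ
  orbitJ-recurrence n = step (orbitJ n) (orbitY n)
    where
    step : ∀ a b → 17 * (17 * a + 12 * b + 12) + 12 * (24 * a + 17 * b + 18) + 12 + a ≡ 34 * (17 * a + 12 * b + 12) + 24
    step = solve-∀

  orbitM-recurrence : Recurrence orbitM
  orbitM-recurrence n = step (orbitJ n) (orbitY n)
    where
    step : ∀ a b → (17 * (17 * a + 12 * b + 12) + 12 * (24 * a + 17 * b + 18) + 12)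
                   + (24 * (17 * a + 12 * b + 12) + 17 * (24 * a + 17 * b + 18) + 18) + (a + b)
                 ≡ 34 * ((17 * a + 12 * b + 12) + (24 * a + 17 * b + 18)) + 24
    step = solve-∀

  orbitJ-GF : HasGF (λ k → + orbitJ k) numJ denJ
  orbitJ-GF 0 = refl
  orbitJ-GF 1 = refl
  orbitJ-GF 2 = refl
  orbitJ-GF 3 = refl
  orbitJ-GF 4 = refl
  orbitJ-GF (suc (suc (suc (suc (suc n))))) = recurrence-annihilated (ℤ.- + 1) {orbitJ} orbitJ-recurrence n

  orbitM-GF : HasGF (λ k → + orbitM k) numM denM
  orbitM-GF 0 = refl
  orbitM-GF 1 = refl
  orbitM-GF 2 = refl
  orbitM-GF 3 = refl
  orbitM-GF 4 = refl
  orbitM-GF (suc (suc (suc (suc (suc n))))) = recurrence-annihilated (+ 1) {orbitM} orbitM-recurrence n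

module IncreasingSequences where
  open import Data.Nat using (zero; s≤s⁻¹)
  open import Data.Nat.Properties using (_<?_; ≤-refl; ≤-trans; <⇒≤; <-≤-trans; ≤-<-trans; ≤-reflexive; <⇒≱; ≮⇒≥; ≤-antisym; m≤n⇒m<n∨m≡n)
  open import Data.Sum using (inj₁; inj₂)
  open import Relation.Nullary using (yes; no; contradiction)

  StrictlyIncreasing : (ℕ → ℕ) → Set
  StrictlyIncreasing f = ∀ k → f k < f (suc k)

  increasing⇒monotone : ∀ {f} → StrictlyIncreasing f → ∀ {a b} → a ≤ b → f a ≤ f b
  increasing⇒monotone inc {b = zero}  z≤n  = ≤-refl
  increasing⇒monotone inc {b = suc b} a≤b with m≤n⇒m<n∨m≡n a≤b
  ... | inj₁ a<b  = ≤-trans (increasing⇒monotone inc (s≤s⁻¹ a<b)) (<⇒≤ (inc b))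
  ... | inj₂ refl = ≤-refl

  increasing-reflects-< : ∀ {f} → StrictlyIncreasing f → ∀ {a b} → f a < f b → a < b
  increasing-reflects-< inc {a} {b} fa<fb with a <? b
  ... | yes a<b = a<b
  ... | no a≮b  = contradiction (increasing⇒monotone inc (≮⇒≥ a≮b)) (<⇒≱ fa<fb)

  range⊆⇒≤ : ∀ {f g} → StrictlyIncreasing f → StrictlyIncreasing g →
             (∀ k → ∃ λ k′ → g k′ ≡ f k) → ∀ k → g k ≤ f k
  range⊆⇒≤ {f} {g} f↑ g↑ f⊆g zero with f⊆g zero
  ... | k′ , gk′≡f0 = ≤-trans (increasing⇒monotone g↑ z≤n) (≤-reflexive gk′≡f0)
  range⊆⇒≤ {f} {g} f↑ g↑ f⊆g (suc k) with f⊆g (suc k)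
  ... | k′ , gk′≡fk+1 = ≤-trans (increasing⇒monotone g↑ k<k′) (≤-reflexive gk′≡fk+1)
    where
    k<k′ : k < k′
    k<k′ = increasing-reflects-< g↑ (≤-<-trans (range⊆⇒≤ f↑ g↑ f⊆g k) (<-≤-trans (f↑ k) (≤-reflexive (sym gk′≡fk+1))))

  sameRange⇒≗ : ∀ {f g} → StrictlyIncreasing f → StrictlyIncreasing g →
                (∀ k → ∃ λ k′ → g k′ ≡ f k) → (∀ k → ∃ λ k′ → f k′ ≡ g k) → ∀ k → f k ≡ g k
  sameRange⇒≗ f↑ g↑ f⊆g g⊆f k = ≤-antisym (range⊆⇒≤ g↑ f↑ g⊆f k) (range⊆⇒≤ f↑ g↑ f⊆g k)

open Factorisation using (ν≡0⇒νRoot; νRoot⇒ν≡0)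
open PellEquation
open GeneratingFunctions using (HasGF-cong)
open IncreasingSequences

orbitJ-increasing : StrictlyIncreasing orbitJ
orbitJ-increasing k = proj₁ (pellOrbit-increasing k)

1≤orbitJ : ∀ k → 1 ≤ orbitJ k
1≤orbitJ k = ≤-trans (s≤s z≤n) (increasing⇒monotone orbitJ-increasing {0} {k} z≤n)

Good⇒inOrbit : ∀ {j} → Good j → ∃ λ k → orbitJ k ≡ j
Good⇒inOrbit {j} (1≤j , m , 1≤m , ν≡0) with νRoot⇒Pell {j} {m} (ν≡0⇒νRoot {j} {m} 1≤j 1≤m ν≡0)
... | y , _ , pell with pellOrbit-complete j y pell
...   | k , e = k , cong proj₁ e

orbitJ-Good : ∀ k → Good (orbitJ k)
orbitJ-Good k = 1≤orbitJ k , orbitM k , ≤-trans (1≤orbitJ k) (m≤m+n (orbitJ k) (orbitY k))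
              , νRoot⇒ν≡0 {orbitJ k} {orbitM k} (Equivalence.to (Pell⇔νRoot {orbitJ k} {orbitY k}) (pellOrbit-Pell k))

ν-root≡orbitM : ∀ k {m} → 1 ≤ m → ν (seqJM (orbitJ k) m) ≡ 0ℤ → m ≡ orbitM k
ν-root≡orbitM k {m} 1≤m ν≡0 = νRoot-unique {orbitJ k} (pellOrbit-Pell k) (ν≡0⇒νRoot {orbitJ k} {m} (1≤orbitJ k) 1≤m ν≡0)

mainTheorem13 : (J M : ℕ → ℕ)
    → (∀ k → J k < J (suc k))
    → (∀ j → Good j ⇔ (∃ λ k → J k ≡ j))
    → (∀ k → (1 ≤ M k) × (ν (seqJM (J k) (M k)) ≡ 0ℤ))
    → HasGF (λ k → + J k) numJ denJ × HasGF (λ k → + M k) numM denM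
mainTheorem13 J M J↑ J-enumerates-Good M-roots =
  HasGF-cong {N = numJ} {denJ} (λ k → cong +_ (orbitJ≡J k)) orbitJ-GF
  , HasGF-cong {N = numM} {denM} (λ k → cong +_ (orbitM≡M k)) orbitM-GF
  where
  orbitJ≡J : ∀ k → orbitJ k ≡ J k
  orbitJ≡J = sameRange⇒≗ orbitJ-increasing J↑
    (λ k → Equivalence.to (J-enumerates-Good (orbitJ k)) (orbitJ-Good k))
    (λ k → Good⇒inOrbit (Equivalence.from (J-enumerates-Good (J k)) (k , refl)))
  orbitM≡M : ∀ k → orbitM k ≡ M k
  orbitM≡M k = sym (ν-root≡orbitM k (proj₁ (M-roots k)) (subst (λ j → ν (seqJM j (M k)) ≡ 0ℤ) (sym (orbitJ≡J k)) (proj₂ (M-roots k))))
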